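{- Let $G$ be a well-covered graph without isolated vertices. The following assertions are equivalent: (i) $G$ belongs to the class $\mathbf{W}_2$; (ii) the differential is monotone on independent sets: if $A\subseteq B$ and $B$ is independent, then $\partial(A)\le\partial(B)$; (iii) every vertex of $G$ is a shedding vertex; (iv) there is no independent set $S$ of $G$ such that $G-N_G[S]$ has an isolated vertex; (v) $G-N_G[v]\in\mathbf{W}_2$ for every $v\in V(G)$.
   Context: Graphs are finite, simple, undirected. An independent set is a set of pairwise non-adjacent vertices; a maximum independent set is one of largest size. A graph is well-covered if all its maximal (by inclusion) independent sets have the same cardinality. A graph belongs to $\mathbf{W}_2$ if every two disjoint independent sets are included, respectively, in two disjoint maximum independent sets; by convention the graph with empty vertex set belongs to $\mathbf{W}_2$. For $A\subseteq V(G)$, $N(A)=\{v: N(v)\cap A\ne\emptyset\}$, $N[A]=N(A)\cup A$, $N[v]=N[\{v\}]$, $G-U$ is the subgraph induced by $V(G)\setminus U$, and $\partial(A)=|N(A)\setminus A|-|A|$. A vertex $v$ is a shedding vertex of $G$ if for every independent set $S$ of $G-N[v]$ there exists $u\in N(v)$ such that $S\cup\{u\}$ is independent. -}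

module Defs where

open import Data.Nat using (ℕ; _≤_)
open import Data.Integer as ℤ using (ℤ; +_; _-_)
open import Data.Bool using (Bool; true; false; _∧_)
open import Data.Fin using (Fin)
open import Data.Fin.Subset using (Subset; _∈_; _∉_; _⊆_; ∁; _∪_; _─_; ∣_∣; ⁅_⁆)
open import Data.Fin.Subset.Properties using (_∈?_)
open import Data.Fin.Properties using (any?)
open import Data.Vec using (tabulate)
open import Data.Product using (Σ; ∃; _×_; _,_)
open import Relation.Nullary using (¬_; does)
open import Relation.Nullary.Decidable using (_×-dec_)
open import Relation.Binary.PropositionalEquality using (_≡_)
open import Data.Bool.Properties using () renaming (_≟_ to _≟ᵇ_)

record Graph (n : ℕ) : Set where
  field
    adj   : Fin n → Fin n → Bool
    sym   : ∀ x y → adj x y ≡ adj y x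
    irrefl : ∀ x → adj x x ≡ false

module _ {n : ℕ} (G : Graph n) where
  open Graph G

  E : Fin n → Fin n → Set
  E x y = adj x y ≡ true

  -- open neighbourhood N(A) = { v : N(v) ∩ A ≠ ∅ }
  N : Subset n → Subset n
  N A = tabulate (λ v → does (any? (λ u → (u ∈? A) ×-dec (adj v u ≟ᵇ true))))

  N[_] : Subset n → Subset n
  N[ A ] = N A ∪ A

  -- vertex set of G - N[A]
  Del : Subset n → Subset n
  Del A = ∁ N[ A ]

  Independent : Subset n → Set
  Independent S = ∀ x y → x ∈ S → y ∈ S → ¬ E x y

  Disjoint : Subset n → Subset n → Set
  Disjoint S T = ∀ x → x ∈ S → x ∉ T

  -- The following notions refer to the induced subgraph G[U] on vertex set U.
  IndepIn : Subset n → Subset n → Set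
  IndepIn U S = S ⊆ U × Independent S

  MaximalIndepIn : Subset n → Subset n → Set
  MaximalIndepIn U S = IndepIn U S × (∀ T → IndepIn U T → S ⊆ T → T ⊆ S)

  MaximumIndepIn : Subset n → Subset n → Set
  MaximumIndepIn U S = IndepIn U S × (∀ T → IndepIn U T → ∣ T ∣ ≤ ∣ S ∣)

  W₂In : Subset n → Set
  W₂In U = ∀ S T → IndepIn U S → IndepIn U T → Disjoint S T →
           ∃ λ S' → ∃ λ T' → MaximumIndepIn U S' × MaximumIndepIn U T' ×
             S ⊆ S' × T ⊆ T' × Disjoint S' T'

  all : Subset n
  all = tabulate (λ _ → true)

  WellCovered : Set
  WellCovered = ∀ S T → MaximalIndepIn all S → MaximalIndepIn all T → ∣ S ∣ ≡ ∣ T ∣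

  NoIsolated : Set
  NoIsolated = ∀ v → ∃ λ u → E v u

  InW₂ : Set
  InW₂ = W₂In all

  ∂ : Subset n → ℤ
  ∂ A = + ∣ N A ─ A ∣ - + ∣ A ∣

  Shedding : Fin n → Set
  Shedding v = ∀ S → IndepIn (Del ⁅ v ⁆) S →
               ∃ λ u → u ∈ N ⁅ v ⁆ × Independent (S ∪ ⁅ u ⁆)

  IsolatedIn : Subset n → Fin n → Set
  IsolatedIn U x = x ∈ U × (∀ y → y ∈ U → ¬ E x y)

  Cond-i : Set
  Cond-i = InW₂

  Cond-ii : Set
  Cond-ii = ∀ A B → A ⊆ B → Independent B → ∂ A ℤ.≤ ∂ B

  Cond-iii : Set
  Cond-iii = ∀ v → Shedding v

  Cond-iv : Set
  Cond-iv = ¬ (∃ λ S → Independent S × ∃ λ x → IsolatedIn (Del S) x)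

  Cond-v : Set
  Cond-v = ∀ v → W₂In (Del ⁅ v ⁆)

-- Everything goes through (iv). Let S be independent, x isolated in G - N[S] and R ⊆ S.
-- Then x has no neighbour in an independent set of G - N[R] containing S \ R, so a
-- maximum independent set of G - N[R] that contains S \ R and avoids x can be enlarged
-- by x; with R = ∅, resp. R = {v} for some v ∈ S, this contradicts (i), resp. (v) (if
-- S = ∅, x is isolated in G itself). Adding x to S increases |S| without enlarging
-- N(S) \ S, against (ii); and a neighbour of x as in (iii) would lie in G - N[S].
-- Conversely, assume (iv) and R independent. An independent set S of G - N[R] that is
-- not maximal there can be enlarged by a vertex outside any given independent set F,
-- since otherwise all of G - N[S ∪ R] lies in F and is isolated. Growing greedily gives
-- the two disjoint maximal sets W₂ asks for in G - N[R]; they are maximum because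
-- G - N[R] inherits well-coveredness from G. For (ii), adding a vertex x to an
-- independent set A raises |A| by one, while (iv) supplies a neighbour of x in
-- G - N[A], which joins N(A) \ A.
module Submission where

open import Defs
open import Data.Nat using (ℕ)
open import Data.Product using (_×_)
open import Function.Bundles using (_⇔_)

open import Data.Nat using (suc; _+_; _≤_; _<_)
open import Data.Nat.Properties
  using (≤-trans; ≤-reflexive; <⇒≱; m≤m+n; +-suc; +-identityʳ; +-comm; +-cancelʳ-≡)
import Data.Integer as ℤ
import Data.Integer.Properties as ℤ
open import Data.Bool using (true; false)
open import Data.Bool.Properties using () renaming (_≟_ to _≟ᵇ_)
open import Data.Fin using (Fin)
open import Data.Fin.Properties using (any?)
open import Data.Fin.Subset
open import Data.Fin.Subset.Properties
open import Data.Fin.Subset.Induction using (Acc; acc; ⊃-wellFounded)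
open import Data.Vec using (_∷_; []; here; there)
open import Data.Vec.Properties using (lookup∘tabulate; []=⇒lookup; lookup⇒[]=)
open import Data.Product using (∃; _,_; proj₁; proj₂)
open import Data.Sum using (_⊎_; inj₁; inj₂; [_,_])
open import Data.Empty using (⊥-elim)
open import Function using (_∘_; flip)
open import Function.Bundles using (mk⇔)
open import Relation.Binary.Bundles using (Preorder)
open import Relation.Nullary using (¬_; Dec; yes; no; does)
open import Relation.Nullary.Decidable
  using (_×-dec_; ¬?; dec-true; decidable-stable)
open import Relation.Unary using (Pred)
open import Relation.Binary.PropositionalEquality
  using (_≡_; _≢_; refl; sym; trans; cong; subst; module ≡-Reasoning)

private
  variable
    n : ℕ
    p q : Subset n
    x : Fin n

does≡true⇒ : ∀ {a} {P : Set a} (P? : Dec P) → does P? ≡ true → P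
does≡true⇒ (yes p) _  = p
does≡true⇒ (no _)  ()

x∈p⇒⁅x⁆⊆p : x ∈ p → ⁅ x ⁆ ⊆ p
x∈p⇒⁅x⁆⊆p {x = x} x∈p y∈⁅x⁆ = subst (_∈ _) (sym (x∈⁅y⁆⇒x≡y x y∈⁅x⁆)) x∈p

x∈p─q⇒x∉q : ∀ (p q : Subset n) → x ∈ p ─ q → x ∉ q
x∈p─q⇒x∉q (_ ∷ p) (true  ∷ q) ()        here
x∈p─q⇒x∉q (_ ∷ p) (false ∷ q) here      ()
x∈p─q⇒x∉q (_ ∷ p) (_     ∷ q) (there m) (there m′) = x∈p─q⇒x∉q p q m m′

p⊂p∪⁅x⁆ : x ∉ p → p ⊂ p ∪ ⁅ x ⁆
p⊂p∪⁅x⁆ {x = x} x∉p = p⊆p∪q ⁅ x ⁆ , x , x∈p∪q⁺ (inj₂ (x∈⁅x⁆ x)) , x∉p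

x∉p∪⁅y⁆ : ∀ {y} → x ∉ p → x ≢ y → x ∉ p ∪ ⁅ y ⁆
x∉p∪⁅y⁆ {p = p} {y = y} x∉p x≢y = [ x∉p , x≢y ∘ x∈⁅y⁆⇒x≡y y ] ∘ x∈p∪q⁻ p ⁅ y ⁆

⊆⊎∃∉ : ∀ (p q : Subset n) → p ⊆ q ⊎ ∃ λ x → x ∈ p × x ∉ q
⊆⊎∃∉ p q with any? (λ x → (x ∈? p) ×-dec ¬? (x ∈? q))
... | yes witness = inj₂ witness
... | no ¬witness = inj₁ λ {x} x∈p → decidable-stable (x ∈? q) (λ x∉q → ¬witness (x , x∈p , x∉q))

∣p∪q∣+∣p∩q∣≡∣p∣+∣q∣ : ∀ (p q : Subset n) → ∣ p ∪ q ∣ + ∣ p ∩ q ∣ ≡ ∣ p ∣ + ∣ q ∣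
∣p∪q∣+∣p∩q∣≡∣p∣+∣q∣ [] [] = refl
∣p∪q∣+∣p∩q∣≡∣p∣+∣q∣ (true ∷ p) (true ∷ q) = cong suc (begin
  ∣ p ∪ q ∣ + suc ∣ p ∩ q ∣  ≡⟨ +-suc ∣ p ∪ q ∣ ∣ p ∩ q ∣ ⟩
  suc (∣ p ∪ q ∣ + ∣ p ∩ q ∣) ≡⟨ cong suc (∣p∪q∣+∣p∩q∣≡∣p∣+∣q∣ p q) ⟩
  suc (∣ p ∣ + ∣ q ∣)         ≡⟨ +-suc ∣ p ∣ ∣ q ∣ ⟨
  ∣ p ∣ + suc ∣ q ∣           ∎)
  where open ≡-Reasoning
∣p∪q∣+∣p∩q∣≡∣p∣+∣q∣ (true ∷ p) (false ∷ q) = cong suc (∣p∪q∣+∣p∩q∣≡∣p∣+∣q∣ p q)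
∣p∪q∣+∣p∩q∣≡∣p∣+∣q∣ (false ∷ p) (true ∷ q) =
  trans (cong suc (∣p∪q∣+∣p∩q∣≡∣p∣+∣q∣ p q)) (sym (+-suc ∣ p ∣ ∣ q ∣))
∣p∪q∣+∣p∩q∣≡∣p∣+∣q∣ (false ∷ p) (false ∷ q) = ∣p∪q∣+∣p∩q∣≡∣p∣+∣q∣ p q

∣p∪q∣≡∣p∣+∣q∣ : ∀ (p q : Subset n) → Empty (p ∩ q) → ∣ p ∪ q ∣ ≡ ∣ p ∣ + ∣ q ∣
∣p∪q∣≡∣p∣+∣q∣ {n} p q disjoint = begin
  ∣ p ∪ q ∣                ≡⟨ +-identityʳ ∣ p ∪ q ∣ ⟨
  ∣ p ∪ q ∣ + 0            ≡⟨ cong (∣ p ∪ q ∣ +_) (∣⊥∣≡0 n) ⟨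
  ∣ p ∪ q ∣ + ∣ ⊥ {n} ∣    ≡⟨ cong (λ r → ∣ p ∪ q ∣ + ∣ r ∣) (Empty-unique disjoint) ⟨
  ∣ p ∪ q ∣ + ∣ p ∩ q ∣    ≡⟨ ∣p∪q∣+∣p∩q∣≡∣p∣+∣q∣ p q ⟩
  ∣ p ∣ + ∣ q ∣            ∎
  where open ≡-Reasoning

∣p∪⁅x⁆∣≤1+∣p∣ : ∀ (p : Subset n) x → ∣ p ∪ ⁅ x ⁆ ∣ ≤ suc ∣ p ∣
∣p∪⁅x⁆∣≤1+∣p∣ p x = ≤-trans (m≤m+n _ ∣ p ∩ ⁅ x ⁆ ∣) (≤-reflexive (begin
  ∣ p ∪ ⁅ x ⁆ ∣ + ∣ p ∩ ⁅ x ⁆ ∣ ≡⟨ ∣p∪q∣+∣p∩q∣≡∣p∣+∣q∣ p ⁅ x ⁆ ⟩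
  ∣ p ∣ + ∣ ⁅ x ⁆ ∣             ≡⟨ cong (∣ p ∣ +_) (∣⁅x⁆∣≡1 x) ⟩
  ∣ p ∣ + 1                     ≡⟨ +-comm ∣ p ∣ 1 ⟩
  suc ∣ p ∣                     ∎))
  where open ≡-Reasoning

⊂-grow : ∀ {ℓ₁ ℓ₂} {P : Pred (Subset n) ℓ₁} {Q : Pred (Subset n) ℓ₂} →
         (∀ {S} → P S → Q S ⊎ ∃ λ S′ → S ⊂ S′ × P S′) →
         ∀ {S} → P S → ∃ λ S′ → S ⊆ S′ × P S′ × Q S′
⊂-grow {P = P} {Q} step {S} = go (⊃-wellFounded S)
  where
  go : ∀ {S} → Acc _⊃_ S → P S → ∃ λ S′ → S ⊆ S′ × P S′ × Q S′
  go (acc larger) pS with step pS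
  ... | inj₁ qS = _ , ⊆-refl , pS , qS
  ... | inj₂ (S′ , S⊂S′ , pS′) with go (larger S⊂S′) pS′
  ...   | S″ , S′⊆S″ , pS″ , qS″ = S″ , ⊆-trans (p⊂q⇒p⊆q S⊂S′) S′⊆S″ , pS″ , qS″

module _ {c ℓ₁ ℓ₂} (P : Preorder c ℓ₁ ℓ₂) where
  open Preorder P using (Carrier; _≲_) renaming (refl to ≲-refl; trans to ≲-trans)

  monotone-on-⊆-by-∪⁅⁆ : ∀ (f : Subset n → Carrier) {B} →
    (∀ S x → S ∪ ⁅ x ⁆ ⊆ B → x ∉ S → f S ≲ f (S ∪ ⁅ x ⁆)) →
    ∀ {A} → A ⊆ B → f A ≲ f B
  monotone-on-⊆-by-∪⁅⁆ f {B} step {A} A⊆B =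
    let S′ , _ , (S′⊆B , fA≲fS′) , B⊆S′ = ⊂-grow {Q = B ⊆_} grow-inside-B (A⊆B , ≲-refl)
    in subst (λ T → f A ≲ f T) (⊆-antisym S′⊆B B⊆S′) fA≲fS′
    where
    grow-inside-B : ∀ {S} → S ⊆ B × f A ≲ f S → B ⊆ S ⊎ ∃ λ S′ → S ⊂ S′ × S′ ⊆ B × f A ≲ f S′
    grow-inside-B {S} (S⊆B , fA≲fS) with ⊆⊎∃∉ B S
    ... | inj₁ B⊆S = inj₁ B⊆S
    ... | inj₂ (x , x∈B , x∉S) =
      inj₂ (S ∪ ⁅ x ⁆ , p⊂p∪⁅x⁆ x∉S , S∪x⊆B , ≲-trans fA≲fS (step S x S∪x⊆B x∉S))
      where
      S∪x⊆B : S ∪ ⁅ x ⁆ ⊆ B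
      S∪x⊆B y∈ = [ S⊆B , x∈p⇒⁅x⁆⊆p x∈B ] (x∈p∪q⁻ S ⁅ x ⁆ y∈)

diff-≤-diff : ∀ {a b c d} → a < c → d ≤ suc b → ℤ.+ a ℤ.- ℤ.+ b ℤ.≤ ℤ.+ c ℤ.- ℤ.+ d
diff-≤-diff {a} {b} {c} {d} a<c d≤1+b = begin
  ℤ.+ a ℤ.- ℤ.+ b  ≡⟨ ℤ.[+m]-[+n]≡m⊖n a b ⟩
  a ℤ.⊖ b          ≡⟨ ℤ.[1+m]⊖[1+n]≡m⊖n a b ⟨
  suc a ℤ.⊖ suc b  ≤⟨ ℤ.⊖-monoˡ-≤ (suc b) a<c ⟩
  c ℤ.⊖ suc b      ≤⟨ ℤ.⊖-monoʳ-≥-≤ c d≤1+b ⟩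
  c ℤ.⊖ d          ≡⟨ ℤ.[+m]-[+n]≡m⊖n c d ⟨
  ℤ.+ c ℤ.- ℤ.+ d  ∎
  where open ℤ.≤-Reasoning

diff-<-diff : ∀ {a b c d} → c ≤ a → b < d → ℤ.+ c ℤ.- ℤ.+ d ℤ.< ℤ.+ a ℤ.- ℤ.+ b
diff-<-diff {a} {b} {c} {d} c≤a b<d = begin-strict
  ℤ.+ c ℤ.- ℤ.+ d  ≡⟨ ℤ.[+m]-[+n]≡m⊖n c d ⟩
  c ℤ.⊖ d          ≤⟨ ℤ.⊖-monoˡ-≤ d c≤a ⟩
  a ℤ.⊖ d          <⟨ ℤ.⊖-monoʳ->-< a b<d ⟩
  a ℤ.⊖ b          ≡⟨ ℤ.[+m]-[+n]≡m⊖n a b ⟨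
  ℤ.+ a ℤ.- ℤ.+ b  ∎
  where open ℤ.≤-Reasoning

module _ (G : Graph n) where

  private
    variable
      A B F R S T U : Subset n
      u v y : Fin n

  -- The decision procedure in the definition of N, so that v ∈ N G A unfolds to it.
  adjacent? : ∀ A v → Dec (∃ λ u → u ∈ A × E G v u)
  adjacent? A v = any? (λ u → (u ∈? A) ×-dec (Graph.adj G v u ≟ᵇ true))

  E-sym : E G u v → E G v u
  E-sym {u} {v} e = trans (Graph.sym G v u) e

  E-irrefl : ¬ E G v v
  E-irrefl {v} e with trans (sym (Graph.irrefl G v)) e
  ... | ()

  ∈N⁺ : u ∈ A → E G v u → v ∈ N G A
  ∈N⁺ {u} {A} {v} u∈A e = lookup⇒[]= v (N G A)
    (trans (lookup∘tabulate _ v) (dec-true (adjacent? A v) (u , u∈A , e)))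

  ∈N⁻ : v ∈ N G A → ∃ λ u → u ∈ A × E G v u
  ∈N⁻ {v} {A} v∈NA =
    does≡true⇒ (adjacent? A v) (trans (sym (lookup∘tabulate _ v)) ([]=⇒lookup v∈NA))

  ∈N⁅⁆⇒E : u ∈ N G ⁅ v ⁆ → E G u v
  ∈N⁅⁆⇒E {v = v} u∈N with ∈N⁻ u∈N
  ... | w , w∈⁅v⁆ , e = subst (E G _) (x∈⁅y⁆⇒x≡y v w∈⁅v⁆) e

  N-mono : A ⊆ B → N G A ⊆ N G B
  N-mono A⊆B v∈NA with ∈N⁻ v∈NA
  ... | u , u∈A , e = ∈N⁺ (A⊆B u∈A) e

  ∈Del⁺ : v ∉ N G A → v ∉ A → v ∈ Del G A
  ∈Del⁺ {A = A} v∉NA v∉A = x∉p⇒x∈∁p (λ v∈ → [ v∉NA , v∉A ] (x∈p∪q⁻ (N G A) A v∈))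

  ∈Del⇒∉N : v ∈ Del G A → v ∉ N G A
  ∈Del⇒∉N v∈Del v∈NA = x∈∁p⇒x∉p v∈Del (x∈p∪q⁺ (inj₁ v∈NA))

  ∈Del⇒∉ : v ∈ Del G A → v ∉ A
  ∈Del⇒∉ v∈Del v∈A = x∈∁p⇒x∉p v∈Del (x∈p∪q⁺ (inj₂ v∈A))

  Del-anti : A ⊆ B → Del G B ⊆ Del G A
  Del-anti A⊆B v∈Del = ∈Del⁺ (∈Del⇒∉N v∈Del ∘ N-mono A⊆B) (∈Del⇒∉ v∈Del ∘ A⊆B)

  ∈Del-∪ : v ∈ Del G A → v ∈ Del G B → v ∈ Del G (A ∪ B)
  ∈Del-∪ {A = A} {B = B} v∈DelA v∈DelB = ∈Del⁺
    (λ v∈N → let u , u∈A∪B , e = ∈N⁻ v∈N in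
      [ ∈Del⇒∉N v∈DelA ∘ flip ∈N⁺ e , ∈Del⇒∉N v∈DelB ∘ flip ∈N⁺ e ] (x∈p∪q⁻ A B u∈A∪B))
    ([ ∈Del⇒∉ v∈DelA , ∈Del⇒∉ v∈DelB ] ∘ x∈p∪q⁻ A B)

  ∈all : v ∈ all G
  ∈all {v} = lookup⇒[]= v (all G) (lookup∘tabulate _ v)

  Empty⇒∈Del : Empty A → v ∈ Del G A
  Empty⇒∈Del {v = v} A-empty =
    ∈Del⁺ (λ v∈NA → let u , u∈A , _ = ∈N⁻ v∈NA in A-empty (u , u∈A)) (λ v∈A → A-empty (v , v∈A))

  Del⊥≡all : Del G ⊥ ≡ all G
  Del⊥≡all = ⊆-antisym (λ _ → ∈all) (λ _ → Empty⇒∈Del (∉⊥ ∘ proj₂))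

  ⊆Del-sym : S ⊆ Del G R → R ⊆ Del G S
  ⊆Del-sym S⊆Del r∈R = ∈Del⁺
    (λ r∈NS → let s , s∈S , e = ∈N⁻ r∈NS in ∈Del⇒∉N (S⊆Del s∈S) (∈N⁺ r∈R (E-sym e)))
    (λ r∈S → ∈Del⇒∉ (S⊆Del r∈S) r∈R)

  Disjoint-sym : Disjoint G S T → Disjoint G T S
  Disjoint-sym S∩T=∅ v v∈T v∈S = S∩T=∅ v v∈S v∈T

  Disjoint-∪⁅⁆ : Disjoint G S T → v ∉ T → Disjoint G (S ∪ ⁅ v ⁆) T
  Disjoint-∪⁅⁆ {S} {T} {v} S∩T=∅ v∉T u u∈S∪v u∈T with x∈p∪q⁻ S ⁅ v ⁆ u∈S∪v
  ... | inj₁ u∈S = S∩T=∅ u u∈S u∈T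
  ... | inj₂ u∈⁅v⁆ = v∉T (subst (_∈ T) (x∈⁅y⁆⇒x≡y v u∈⁅v⁆) u∈T)

  independent-⊆ : A ⊆ B → Independent G B → Independent G A
  independent-⊆ A⊆B indB x y x∈A y∈A = indB x y (A⊆B x∈A) (A⊆B y∈A)

  independent-⊥ : Independent G ⊥
  independent-⊥ _ _ x∈⊥ = ⊥-elim (∉⊥ x∈⊥)

  independent-⁅⁆ : Independent G ⁅ v ⁆
  independent-⁅⁆ {v} x y x∈ y∈ rewrite x∈⁅y⁆⇒x≡y v x∈ | x∈⁅y⁆⇒x≡y v y∈ = E-irrefl

  independent-∪ : Independent G S → Independent G R → R ⊆ Del G S → Independent G (S ∪ R)
  independent-∪ {S} {R} indS indR R⊆Del x y x∈ y∈ with x∈p∪q⁻ S R x∈ | x∈p∪q⁻ S R y∈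
  ... | inj₁ x∈S | inj₁ y∈S = indS x y x∈S y∈S
  ... | inj₂ x∈R | inj₂ y∈R = indR x y x∈R y∈R
  ... | inj₁ x∈S | inj₂ y∈R = ∈Del⇒∉N (R⊆Del y∈R) ∘ ∈N⁺ x∈S ∘ E-sym
  ... | inj₂ x∈R | inj₁ y∈S = ∈Del⇒∉N (R⊆Del x∈R) ∘ ∈N⁺ y∈S

  independent-∪⁅⁆ : Independent G S → v ∈ Del G S → Independent G (S ∪ ⁅ v ⁆)
  independent-∪⁅⁆ indS v∈Del = independent-∪ indS independent-⁅⁆ (x∈p⇒⁅x⁆⊆p v∈Del)

  independent⇒∉N : Independent G T → S ⊆ T → v ∈ T → v ∉ N G S
  independent⇒∉N indT S⊆T v∈T v∈NS with ∈N⁻ v∈NS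
  ... | u , u∈S , e = indT _ u v∈T (S⊆T u∈S) e

  independent-∪⁅⁆⁻ : Independent G (S ∪ ⁅ v ⁆) → v ∉ S → v ∈ Del G S
  independent-∪⁅⁆⁻ {S} {v} indS∪v =
    ∈Del⁺ (independent⇒∉N indS∪v (p⊆p∪q ⁅ v ⁆) (x∈p∪q⁺ (inj₂ (x∈⁅x⁆ v))))

  independent⇒─⊆Del : Independent G S → R ⊆ S → S ─ R ⊆ Del G R
  independent⇒─⊆Del {S} {R} indS R⊆S v∈S─R =
    ∈Del⁺ (independent⇒∉N indS R⊆S (p─q⊆p S R v∈S─R)) (x∈p─q⇒x∉q S R v∈S─R)

  WellCoveredIn : Subset n → Set
  WellCoveredIn U = ∀ S T → MaximalIndepIn G U S → MaximalIndepIn G U T → ∣ S ∣ ≡ ∣ T ∣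

  add-vertex : IndepIn G U S → v ∈ U → v ∈ Del G S → S ⊂ S ∪ ⁅ v ⁆ × IndepIn G U (S ∪ ⁅ v ⁆)
  add-vertex {S = S} (S⊆U , indS) v∈U v∈Del =
    p⊂p∪⁅x⁆ (∈Del⇒∉ v∈Del) ,
    (λ x∈ → [ S⊆U , x∈p⇒⁅x⁆⊆p v∈U ] (x∈p∪q⁻ S _ x∈)) ,
    independent-∪⁅⁆ indS v∈Del

  no-addable⇒maximal : IndepIn G U S → (∀ v → v ∈ U → v ∉ Del G S) → MaximalIndepIn G U S
  no-addable⇒maximal {U} {S} indS no-addable = indS , is-maximal
    where
    is-maximal : ∀ T → IndepIn G U T → S ⊆ T → T ⊆ S
    is-maximal T (T⊆U , indT) S⊆T {v} v∈T = decidable-stable (v ∈? S) λ v∉S →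
      no-addable v (T⊆U v∈T) (∈Del⁺ (independent⇒∉N indT S⊆T v∈T) v∉S)

  maximal⇒no-addable : MaximalIndepIn G U S → v ∈ U → v ∉ Del G S
  maximal⇒no-addable {S = S} (indS , is-maximal) v∈U v∈Del =
    let _ , indS∪v = add-vertex indS v∈U v∈Del
    in ∈Del⇒∉ v∈Del (is-maximal _ indS∪v (p⊆p∪q _) (x∈p∪q⁺ (inj₂ (x∈⁅x⁆ _))))

  maximum⇒no-addable : MaximumIndepIn G U S → v ∈ U → v ∉ Del G S
  maximum⇒no-addable (indS , is-maximum) v∈U v∈Del =
    let S⊂S∪v , indS∪v = add-vertex indS v∈U v∈Del
    in <⇒≱ (p⊂q⇒∣p∣<∣q∣ S⊂S∪v) (is-maximum _ indS∪v)

  neighbour-in : v ∈ U → ¬ IsolatedIn G U v → ∃ λ u → u ∈ U × E G v u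
  neighbour-in {v} {U} v∈U not-isolated = decidable-stable (adjacent? U v)
    λ none → not-isolated (v∈U , λ u u∈U e → none (u , u∈U , e))

  maximal-or-addable : IndepIn G U S → MaximalIndepIn G U S ⊎ ∃ λ v → v ∈ U × v ∈ Del G S
  maximal-or-addable {U} {S} indS with ⊆⊎∃∉ U (∁ (Del G S))
  ... | inj₁ U⊆∁Del = inj₁ (no-addable⇒maximal indS λ v v∈U → x∈∁p⇒x∉p (U⊆∁Del v∈U))
  ... | inj₂ (v , v∈U , v∉∁Del) = inj₂ (v , v∈U , x∉∁p⇒x∈p v∉∁Del)

  extend-to-maximal : IndepIn G U S → ∃ λ S′ → S ⊆ S′ × MaximalIndepIn G U S′
  extend-to-maximal {U} indS =
    let S′ , S⊆S′ , _ , maxS′ = ⊂-grow step indS in S′ , S⊆S′ , maxS′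
    where
    step : IndepIn G U S → MaximalIndepIn G U S ⊎ ∃ λ S′ → S ⊂ S′ × IndepIn G U S′
    step indS with maximal-or-addable indS
    ... | inj₁ maxS = inj₁ maxS
    ... | inj₂ (v , v∈U , v∈Del) = inj₂ (_ , add-vertex indS v∈U v∈Del)

  maximal⇒maximum : WellCoveredIn U → MaximalIndepIn G U S → MaximumIndepIn G U S
  maximal⇒maximum {S = S} well-covered maxS = proj₁ maxS , λ T indT →
    let T′ , T⊆T′ , maxT′ = extend-to-maximal indT
    in ≤-trans (p⊆q⇒∣p∣≤∣q∣ T⊆T′) (≤-reflexive (well-covered T′ S maxT′ maxS))

  maximal-in-Del⇒maximal-∪ : Independent G R → MaximalIndepIn G (Del G R) S →
                             MaximalIndepIn G (all G) (S ∪ R)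
  maximal-in-Del⇒maximal-∪ {R} {S} indR maxS@((S⊆Del , indS) , _) = no-addable⇒maximal
    ((λ _ → ∈all) , independent-∪ indS indR (⊆Del-sym S⊆Del))
    (λ v _ v∈Del → maximal⇒no-addable maxS (Del-anti (q⊆p∪q S R) v∈Del) (Del-anti (p⊆p∪q R) v∈Del))

  well-covered⇒well-covered-Del : WellCovered G → Independent G R → WellCoveredIn (Del G R)
  well-covered⇒well-covered-Del {R} well-covered indR S T maxS maxT =
    +-cancelʳ-≡ (∣ R ∣) (∣ S ∣) (∣ T ∣) (begin
    ∣ S ∣ + ∣ R ∣  ≡⟨ ∣∪R∣ maxS ⟨
    ∣ S ∪ R ∣      ≡⟨ well-covered _ _ (maximal-in-Del⇒maximal-∪ indR maxS)
                                       (maximal-in-Del⇒maximal-∪ indR maxT) ⟩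
    ∣ T ∪ R ∣      ≡⟨ ∣∪R∣ maxT ⟩
    ∣ T ∣ + ∣ R ∣  ∎)
    where
    open ≡-Reasoning
    ∣∪R∣ : ∀ {S} → MaximalIndepIn G (Del G R) S → ∣ S ∪ R ∣ ≡ ∣ S ∣ + ∣ R ∣
    ∣∪R∣ {S} ((S⊆Del , _) , _) = ∣p∪q∣≡∣p∣+∣q∣ S R λ (v , v∈S∩R) →
      let v∈S , v∈R = x∈p∩q⁻ S R v∈S∩R in ∈Del⇒∉ (S⊆Del v∈S) v∈R

  isolated⇒∉N : IsolatedIn G (Del G S) v → Independent G T → T ⊆ Del G R → S ─ R ⊆ T → v ∉ N G T
  isolated⇒∉N {S} {v} {T} {R} (v∈DelS , isolated) indT T⊆DelR S─R⊆T v∈NT =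
    let w , w∈T , e = ∈N⁻ v∈NT
    in isolated w (∈Del⁺ (w∉NS w∈T) (∈Del⇒∉N v∈DelS ∘ λ w∈S → ∈N⁺ w∈S e)) e
    where
    w∉NS : ∀ {w} → w ∈ T → w ∉ N G S
    w∉NS w∈T w∈NS with ∈N⁻ w∈NS
    ... | s , s∈S , e with s ∈? R
    ...   | yes s∈R = ∈Del⇒∉N (T⊆DelR w∈T) (∈N⁺ s∈R e)
    ...   | no s∉R = indT _ s w∈T (S─R⊆T (x∈p∧x∉q⇒x∈p─q s∈S s∉R)) e

  W₂In-Del⇒no-isolated : W₂In G (Del G R) → Independent G S → R ⊆ S → ¬ IsolatedIn G (Del G S) v
  W₂In-Del⇒no-isolated {R} {S} {v} w₂ indS R⊆S iso@(v∈DelS , _) =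
    let S′ , T′ , maxS′ , _ , S─R⊆S′ , ⁅v⁆⊆T′ , S′∩T′=∅ =
          w₂ (S ─ R) ⁅ v ⁆ (independent⇒─⊆Del indS R⊆S , independent-⊆ (p─q⊆p S R) indS)
             (x∈p⇒⁅x⁆⊆p v∈DelR , independent-⁅⁆) S─R∩⁅v⁆=∅
        S′⊆DelR , indS′ = proj₁ maxS′
        v∉S′ = λ v∈S′ → S′∩T′=∅ v v∈S′ (⁅v⁆⊆T′ (x∈⁅x⁆ v))
    in maximum⇒no-addable maxS′ v∈DelR (∈Del⁺ (isolated⇒∉N iso indS′ S′⊆DelR S─R⊆S′) v∉S′)
    where
    v∈DelR : v ∈ Del G R
    v∈DelR = Del-anti R⊆S v∈DelS
    S─R∩⁅v⁆=∅ : Disjoint G (S ─ R) ⁅ v ⁆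
    S─R∩⁅v⁆=∅ w w∈S─R w∈⁅v⁆ =
      ∈Del⇒∉ v∈DelS (subst (_∈ S) (x∈⁅y⁆⇒x≡y v w∈⁅v⁆) (p─q⊆p S R w∈S─R))

  module _ (cond-iv : Cond-iv G) {R} (indR : Independent G R) where

    addable-outside : IndepIn G (Del G R) S → Independent G F → v ∈ Del G R → v ∈ Del G S →
                      ∃ λ u → u ∈ Del G R × u ∈ Del G S × u ∉ F
    addable-outside {S} {F} {v} (S⊆DelR , indS) indF v∈DelR v∈DelS with ⊆⊎∃∉ (Del G (S ∪ R)) F
    ... | inj₂ (u , u∈Del , u∉F) = u , Del-anti (q⊆p∪q S R) u∈Del , Del-anti (p⊆p∪q R) u∈Del , u∉F
    ... | inj₁ Del⊆F = ⊥-elim (cond-iv (S ∪ R , independent-∪ indS indR (⊆Del-sym S⊆DelR) ,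
                                        v , v∈Del , λ y y∈Del → indF v y (Del⊆F v∈Del) (Del⊆F y∈Del)))
      where
      v∈Del : v ∈ Del G (S ∪ R)
      v∈Del = ∈Del-∪ v∈DelS v∈DelR

    extend-avoiding : IndepIn G (Del G R) F → IndepIn G (Del G R) S → Disjoint G S F →
                      ∃ λ S′ → S ⊆ S′ × MaximalIndepIn G (Del G R) S′ × Disjoint G S′ F
    extend-avoiding {F} (_ , indF) indS S∩F=∅ =
      let S′ , S⊆S′ , (_ , S′∩F=∅) , maxS′ = ⊂-grow step (indS , S∩F=∅)
      in S′ , S⊆S′ , maxS′ , S′∩F=∅
      where
      step : IndepIn G (Del G R) S × Disjoint G S F →
             MaximalIndepIn G (Del G R) S ⊎
             ∃ λ S′ → S ⊂ S′ × IndepIn G (Del G R) S′ × Disjoint G S′ F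
      step (indS , S∩F=∅) with maximal-or-addable indS
      ... | inj₁ maxS = inj₁ maxS
      ... | inj₂ (v , v∈DelR , v∈DelS) =
        let u , u∈DelR , u∈DelS , u∉F = addable-outside indS indF v∈DelR v∈DelS
            S⊂S∪u , indS∪u = add-vertex indS u∈DelR u∈DelS
        in inj₂ (_ , S⊂S∪u , indS∪u , Disjoint-∪⁅⁆ S∩F=∅ u∉F)

    no-isolated⇒W₂In-Del : WellCoveredIn (Del G R) → W₂In G (Del G R)
    no-isolated⇒W₂In-Del well-covered S T indS indT S∩T=∅ =
      let S′ , S⊆S′ , maxS′ , S′∩T=∅ = extend-avoiding indT indS S∩T=∅
          T′ , T⊆T′ , maxT′ , T′∩S′=∅ = extend-avoiding (proj₁ maxS′) indT (Disjoint-sym S′∩T=∅)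
      in S′ , T′ , maximal⇒maximum well-covered maxS′ , maximal⇒maximum well-covered maxT′ ,
         S⊆S′ , T⊆T′ , Disjoint-sym T′∩S′=∅

  Boundary : Subset n → Subset n
  Boundary A = N G A ─ A

  Boundary-⊂-∪⁅⁆ : v ∈ Del G A → u ∈ Del G A → E G v u → Boundary A ⊂ Boundary (A ∪ ⁅ v ⁆)
  Boundary-⊂-∪⁅⁆ {v} {A} {u} v∈DelA u∈DelA e =
    old⊆new , u , u∈new , ∈Del⇒∉N u∈DelA ∘ p─q⊆p (N G A) A
    where
    old⊆new : Boundary A ⊆ Boundary (A ∪ ⁅ v ⁆)
    old⊆new w∈ = let w∈NA = p─q⊆p (N G A) A w∈ in
      x∈p∧x∉q⇒x∈p─q (N-mono (p⊆p∪q ⁅ v ⁆) w∈NA)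
        (x∉p∪⁅y⁆ (x∈p─q⇒x∉q (N G A) A w∈) λ { refl → ∈Del⇒∉N v∈DelA w∈NA })
    u∈new : u ∈ Boundary (A ∪ ⁅ v ⁆)
    u∈new = x∈p∧x∉q⇒x∈p─q (∈N⁺ (x∈p∪q⁺ (inj₂ (x∈⁅x⁆ v))) (E-sym e))
              (x∉p∪⁅y⁆ (∈Del⇒∉ u∈DelA) λ { refl → E-irrefl e })

  Boundary-∪⁅⁆⊆ : IsolatedIn G (Del G S) v → Boundary (S ∪ ⁅ v ⁆) ⊆ Boundary S
  Boundary-∪⁅⁆⊆ {S} {v} (_ , isolated) {w} w∈ = x∈p∧x∉q⇒x∈p─q w∈NS w∉S
    where
    w∉S : w ∉ S
    w∉S = x∈p─q⇒x∉q _ (S ∪ ⁅ v ⁆) w∈ ∘ p⊆p∪q ⁅ v ⁆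
    w∈NS : w ∈ N G S
    w∈NS with ∈N⁻ (p─q⊆p (N G (S ∪ ⁅ v ⁆)) _ w∈)
    ... | u , u∈S∪v , e with x∈p∪q⁻ S ⁅ v ⁆ u∈S∪v
    ...   | inj₁ u∈S = ∈N⁺ u∈S e
    ...   | inj₂ u∈⁅v⁆ rewrite x∈⁅y⁆⇒x≡y v u∈⁅v⁆ =
      decidable-stable (w ∈? N G S) λ w∉NS → isolated w (∈Del⁺ w∉NS w∉S) (E-sym e)

  ∂-mono-∪⁅⁆ : Cond-iv G → Independent G (A ∪ ⁅ v ⁆) → v ∉ A → ∂ G A ℤ.≤ ∂ G (A ∪ ⁅ v ⁆)
  ∂-mono-∪⁅⁆ {A} {v} cond-iv indA∪v v∉A =
    let u , u∈DelA , e = neighbour-in v∈DelA λ iso → cond-iv (A , indA , v , iso)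
    in diff-≤-diff (p⊂q⇒∣p∣<∣q∣ (Boundary-⊂-∪⁅⁆ v∈DelA u∈DelA e)) (∣p∪⁅x⁆∣≤1+∣p∣ A v)
    where
    indA : Independent G A
    indA = independent-⊆ (p⊆p∪q ⁅ v ⁆) indA∪v
    v∈DelA : v ∈ Del G A
    v∈DelA = independent-∪⁅⁆⁻ indA∪v v∉A

  i⇒iv : Cond-i G → Cond-iv G
  i⇒iv w₂ (S , indS , v , iso) =
    W₂In-Del⇒no-isolated (subst (W₂In G) (sym Del⊥≡all) w₂) indS ⊥⊆ iso

  iv⇒i : WellCovered G → Cond-iv G → Cond-i G
  iv⇒i well-covered cond-iv = subst (W₂In G) Del⊥≡all (no-isolated⇒W₂In-Del cond-iv independent-⊥
    (well-covered⇒well-covered-Del well-covered independent-⊥))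

  ii⇒iv : Cond-ii G → Cond-iv G
  ii⇒iv cond-ii (S , indS , v , iso@(v∈DelS , _)) = ℤ.<⇒≱
    (diff-<-diff (p⊆q⇒∣p∣≤∣q∣ (Boundary-∪⁅⁆⊆ iso)) (p⊂q⇒∣p∣<∣q∣ (p⊂p∪⁅x⁆ (∈Del⇒∉ v∈DelS))))
    (cond-ii S (S ∪ ⁅ v ⁆) (p⊆p∪q ⁅ v ⁆) (independent-∪⁅⁆ indS v∈DelS))

  iv⇒ii : Cond-iv G → Cond-ii G
  iv⇒ii cond-iv A B A⊆B indB = monotone-on-⊆-by-∪⁅⁆ ℤ.≤-preorder (∂ G)
    (λ S v S∪v⊆B v∉S → ∂-mono-∪⁅⁆ cond-iv (independent-⊆ S∪v⊆B indB) v∉S) A⊆B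

  iii⇒iv : Cond-iii G → Cond-iv G
  iii⇒iv shedding (S , indS , v , v∈DelS , isolated) =
    let u , u∈Nv , indS∪u = shedding v S (⊆Del-sym (x∈p⇒⁅x⁆⊆p v∈DelS) , indS)
        e = E-sym (∈N⁅⁆⇒E u∈Nv)
    in isolated u (independent-∪⁅⁆⁻ indS∪u λ u∈S → ∈Del⇒∉N v∈DelS (∈N⁺ u∈S e)) e

  iv⇒iii : Cond-iv G → Cond-iii G
  iv⇒iii cond-iv v S (S⊆Delv , indS) =
    let u , u∈DelS , e = neighbour-in v∈DelS λ iso → cond-iv (S , indS , v , iso)
    in u , ∈N⁺ (x∈⁅x⁆ v) (E-sym e) , independent-∪⁅⁆ indS u∈DelS
    where
    v∈DelS : v ∈ Del G S
    v∈DelS = ⊆Del-sym S⊆Delv (x∈⁅x⁆ v)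

  v⇒iv : NoIsolated G → Cond-v G → Cond-iv G
  v⇒iv no-isolated cond-v (S , indS , v , iso@(_ , isolated)) with nonempty? S
  ... | yes (u , u∈S) = W₂In-Del⇒no-isolated (cond-v u) indS (x∈p⇒⁅x⁆⊆p u∈S) iso
  ... | no S-empty = let u , e = no-isolated v in isolated u (Empty⇒∈Del S-empty) e

  iv⇒v : WellCovered G → Cond-iv G → Cond-v G
  iv⇒v well-covered cond-iv v = no-isolated⇒W₂In-Del cond-iv independent-⁅⁆
    (well-covered⇒well-covered-Del well-covered independent-⁅⁆)

theorem3p9 : ∀ {n : ℕ} (G : Graph n) → WellCovered G → NoIsolated G →
    ((Cond-i G ⇔ Cond-ii G) × (Cond-i G ⇔ Cond-iii G) ×
     (Cond-i G ⇔ Cond-iv G) × (Cond-i G ⇔ Cond-v G))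
theorem3p9 G well-covered no-isolated =
  mk⇔ (iv⇒ii G ∘ i⇒iv G) (iv⇒i G well-covered ∘ ii⇒iv G) ,
  mk⇔ (iv⇒iii G ∘ i⇒iv G) (iv⇒i G well-covered ∘ iii⇒iv G) ,
  mk⇔ (i⇒iv G) (iv⇒i G well-covered) ,
  mk⇔ (iv⇒v G well-covered ∘ i⇒iv G) (iv⇒i G well-covered ∘ v⇒iv G no-isolated)
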